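{- Let $G$ be a connected finite simple graph of order $n\geq 2$, and let $I$ be a maximum independent set of $G$. Then $$\chi_{md}(G)\leq n+1-\alpha(G)-\nu\big(\overline{G\setminus I}\big).$$
   Context: For a vertex $v$, $N[v]=N(v)\cup\{v\}$; $v$ dominates exactly the vertices of $N[v]$. A majority dominator coloring of $G$ is a proper vertex coloring such that for every vertex $v$ there is a color class $C$ with $|N[v]\cap C|\geq |C|/2$. $\chi_{md}(G)$ is the minimum number of color classes in a majority dominator coloring. $\alpha(G)$ is the independence number, $G\setminus I$ is the subgraph induced by $V(G)\setminus I$, $\overline{H}$ is the complement of $H$, and $\nu(H)$ is the matching number (size of a maximum matching) of $H$. -}

module Defs where

open import Data.Nat using (ℕ; _≤_; _*_)
open import Data.Bool using (Bool; true; false; not; _∨_; _∧_; T)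
open import Data.Fin using (Fin)
open import Data.Fin.Properties using () renaming (_≟_ to _≟ᶠ_)
open import Data.Fin.Subset using (Subset; _∈_; _∉_; ∣_∣; _∩_)
open import Data.Vec using (tabulate)
open import Data.List using (List; length; []; _∷_; concatMap)
open import Data.List.Relation.Unary.All using (All)
open import Data.List.Relation.Unary.Unique.Propositional using (Unique)
open import Data.Product using (_×_; _,_; Σ; ∃; ∃-syntax; proj₁; proj₂)
open import Function using (Surjective)
open import Relation.Binary.PropositionalEquality using (_≡_; _≢_)
open import Relation.Nullary.Decidable using (⌊_⌋)

record SimpleGraph (n : ℕ) : Set where
  field
    Adj   : Fin n → Fin n → Bool
    adj-sym : ∀ u v → Adj u v ≡ Adj v u
    adj-irrefl : ∀ v → Adj v v ≡ false
open SimpleGraph public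

module _ {n : ℕ} (G : SimpleGraph n) where

  data Reach : Fin n → Fin n → Set where
    here : ∀ {v} → Reach v v
    step : ∀ {u w v} → T (Adj G u w) → Reach w v → Reach u v

  Connected : Set
  Connected = ∀ u v → Reach u v

  ClosedNbhd : Fin n → Subset n
  ClosedNbhd v = tabulate (λ u → ⌊ u ≟ᶠ v ⌋ ∨ Adj G v u)

  Independent : Subset n → Set
  Independent I = ∀ u v → u ∈ I → v ∈ I → Adj G u v ≡ false

  MaximumIndependent : Subset n → Set
  MaximumIndependent I = Independent I × (∀ J → Independent J → ∣ J ∣ ≤ ∣ I ∣)

  IsIndependenceNumber : ℕ → Set
  IsIndependenceNumber k =
    (∃[ I ] (Independent I × ∣ I ∣ ≡ k)) × (∀ J → Independent J → ∣ J ∣ ≤ k)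

  -- a matching of G all of whose edges lie inside the vertex set S,
  -- i.e. a matching of the induced subgraph G[S]
  endpoints : List (Fin n × Fin n) → List (Fin n)
  endpoints = concatMap (λ e → proj₁ e ∷ proj₂ e ∷ [])

  IsMatchingIn : Subset n → List (Fin n × Fin n) → Set
  IsMatchingIn S M =
    All (λ e → proj₁ e ∈ S × proj₂ e ∈ S × T (Adj G (proj₁ e) (proj₂ e))) M
    × Unique (endpoints M)

  IsMatchingNumberIn : Subset n → ℕ → Set
  IsMatchingNumberIn S m =
    (∃[ M ] (IsMatchingIn S M × length M ≡ m))
    × (∀ M → IsMatchingIn S M → length M ≤ m)

  ColourClass : {k : ℕ} → (Fin n → Fin k) → Fin k → Subset n
  ColourClass c i = tabulate (λ u → ⌊ c u ≟ᶠ i ⌋)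

  IsMDColouring : (k : ℕ) → (Fin n → Fin k) → Set
  IsMDColouring k c =
    Surjective _≡_ _≡_ c
    × (∀ u v → T (Adj G u v) → c u ≢ c v)
    × (∀ v → ∃[ i ] (∣ ColourClass c i ∣ ≤ 2 * ∣ ClosedNbhd v ∩ ColourClass c i ∣))

  IsMDChromaticNumber : ℕ → Set
  IsMDChromaticNumber k =
    (∃[ c ] IsMDColouring k c)
    × (∀ k' (c : Fin n → Fin k') → IsMDColouring k' c → k ≤ k')

complement : {n : ℕ} → SimpleGraph n → SimpleGraph n
complement {n} G = record
  { Adj = λ u v → not ⌊ u ≟ᶠ v ⌋ ∧ not (Adj G u v)
  ; adj-sym = pf
  ; adj-irrefl = pf2
  }
  where
  open import Relation.Binary.PropositionalEquality using (refl; cong₂; cong; sym)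
  open import Relation.Nullary using (yes; no)
  open import Data.Bool.Properties using ()
  pf : ∀ u v → (not ⌊ u ≟ᶠ v ⌋ ∧ not (Adj G u v)) ≡ (not ⌊ v ≟ᶠ u ⌋ ∧ not (Adj G v u))
  pf u v with u ≟ᶠ v | v ≟ᶠ u
  ... | yes _ | yes _ = refl
  ... | no _  | no _  = cong not (SimpleGraph.adj-sym G u v)
  ... | yes p | no q  = Data.Empty.⊥-elim (q (sym p)) where import Data.Empty
  ... | no p  | yes q = Data.Empty.⊥-elim (p (sym q)) where import Data.Empty
  pf2 : ∀ v → (not ⌊ v ≟ᶠ v ⌋ ∧ not (Adj G v v)) ≡ false
  pf2 v with v ≟ᶠ v
  ... | yes _ = refl
  ... | no q = Data.Empty.⊥-elim (q refl) where import Data.Empty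

-- Give I a single colour, give the two endpoints of each edge of a maximum
-- matching M of the complement of G - I a common colour, and every other vertex
-- its own colour.  This is proper, and uses at most n + 1 - |I| - |M| colours.
-- Every colour class outside I has at most two vertices, so it is a majority of
-- N[v] as soon as it meets N[v]; and N[v] always meets V - I, since a vertex of I
-- has a neighbour (G is connected with n >= 2) and that neighbour is not in I.
module Submission where

open import Defs
open import Data.Nat using (ℕ; zero; suc; _+_; _*_; _∸_; _≤_; s≤s)
open import Data.Nat.Properties
  using ( +-suc; +-assoc; +-comm; +-identityʳ; m≤m+n; ≤-trans; ≤-reflexive; +-monoˡ-≤; +-monoʳ-≤
        ; *-monoʳ-≤; ∸-+-assoc; m+n≤o⇒m≤o∸n; ∸-monoˡ-≤; ∸-monoʳ-≤; module ≤-Reasoning)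
open import Data.Bool using (Bool; true; false; T)
open import Data.Bool.Properties using (T-≡; T-not-≡; T-∧; T-∨)
open import Data.Empty using (⊥-elim-irr)
open import Data.Fin using (Fin; zero; suc; fromℕ<)
open import Data.Fin.Properties using (any?; suc-injective) renaming (_≟_ to _≟ᶠ_)
open import Data.Fin.Subset using (Subset; _∈_; _∉_; _⊆_; ∣_∣; _∪_; _∩_; ⁅_⁆; ⊥; ∁; Empty; Nonempty)
open import Data.Fin.Subset.Properties
  using ( _∈?_; nonempty?; drop-there; ∉⊥; x∈⁅x⁆; x∈⁅y⁆⇒x≡y; x∈∁p⇒x∉p; x∈p∩q⁺; x∈p∩q⁻; x∈p∪q⁺; x∈p∪q⁻
        ; Empty-unique; ∣⊥∣≡0; ∣p∣≤n; ∣⁅x⁆∣≡1; p⊆q⇒∣p∣≤∣q∣)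
open import Data.Vec using ([]; _∷_; tabulate; here; there)
open import Data.Vec.Properties using (lookup⇒[]=; []=⇒lookup; lookup∘tabulate)
open import Data.Product using (_×_; _,_; Σ; ∃-syntax; proj₁; proj₂)
open import Data.Sum as Sum using (_⊎_; inj₁; inj₂; [_,_]′)
open import Data.List using (List; []; _∷_; length; concatMap)
open import Data.List.Relation.Unary.All as All using (All; []; _∷_)
open import Data.List.Relation.Unary.Unique.Propositional using (Unique)
open import Data.List.Relation.Unary.AllPairs using ([]; _∷_)
open import Function using (_∘_; case_of_; Surjective; Equivalence)
open import Relation.Binary.PropositionalEquality
  using (_≡_; _≢_; refl; sym; trans; cong; cong₂; subst; module ≡-Reasoning)
open import Relation.Nullary using (Dec; yes; no; ¬_; contradiction)
open import Relation.Nullary.Decidable using (⌊_⌋; fromWitness; toWitness)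

private
  variable
    n : ℕ

∈-tabulate⁺ : {f : Fin n → Bool} {x : Fin n} → T (f x) → x ∈ tabulate f
∈-tabulate⁺ {f = f} {x} fx = lookup⇒[]= x (tabulate f) (trans (lookup∘tabulate f x) (Equivalence.to T-≡ fx))

∈-tabulate⁻ : {f : Fin n → Bool} {x : Fin n} → x ∈ tabulate f → T (f x)
∈-tabulate⁻ {f = f} {x} x∈ = Equivalence.from T-≡ (trans (sym (lookup∘tabulate f x)) ([]=⇒lookup x∈))

∣p∪q∣+∣p∩q∣≡∣p∣+∣q∣ : (p q : Subset n) → ∣ p ∪ q ∣ + ∣ p ∩ q ∣ ≡ ∣ p ∣ + ∣ q ∣
∣p∪q∣+∣p∩q∣≡∣p∣+∣q∣ []            []            = refl
∣p∪q∣+∣p∩q∣≡∣p∣+∣q∣ (true  ∷ p) (true  ∷ q) =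
  cong suc (trans (+-suc _ _) (trans (cong suc (∣p∪q∣+∣p∩q∣≡∣p∣+∣q∣ p q)) (sym (+-suc _ _))))
∣p∪q∣+∣p∩q∣≡∣p∣+∣q∣ (true  ∷ p) (false ∷ q) = cong suc (∣p∪q∣+∣p∩q∣≡∣p∣+∣q∣ p q)
∣p∪q∣+∣p∩q∣≡∣p∣+∣q∣ (false ∷ p) (true  ∷ q) = trans (cong suc (∣p∪q∣+∣p∩q∣≡∣p∣+∣q∣ p q)) (sym (+-suc _ _))
∣p∪q∣+∣p∩q∣≡∣p∣+∣q∣ (false ∷ p) (false ∷ q) = ∣p∪q∣+∣p∩q∣≡∣p∣+∣q∣ p q

Disjoint : Subset n → Subset n → Set
Disjoint p q = ∀ {x} → x ∈ p → x ∉ q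

∣p∪q∣≤∣p∣+∣q∣ : (p q : Subset n) → ∣ p ∪ q ∣ ≤ ∣ p ∣ + ∣ q ∣
∣p∪q∣≤∣p∣+∣q∣ p q = ≤-trans (m≤m+n _ _) (≤-reflexive (∣p∪q∣+∣p∩q∣≡∣p∣+∣q∣ p q))

disjoint⇒∣p∪q∣≡∣p∣+∣q∣ : (p q : Subset n) → Disjoint p q → ∣ p ∪ q ∣ ≡ ∣ p ∣ + ∣ q ∣
disjoint⇒∣p∪q∣≡∣p∣+∣q∣ {n} p q p#q = begin
  ∣ p ∪ q ∣             ≡⟨ +-identityʳ _ ⟨
  ∣ p ∪ q ∣ + 0         ≡⟨ cong (∣ p ∪ q ∣ +_) ∣p∩q∣≡0 ⟨
  ∣ p ∪ q ∣ + ∣ p ∩ q ∣ ≡⟨ ∣p∪q∣+∣p∩q∣≡∣p∣+∣q∣ p q ⟩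
  ∣ p ∣ + ∣ q ∣         ∎
  where
  open ≡-Reasoning
  p∩q-empty : Empty (p ∩ q)
  p∩q-empty (x , x∈p∩q) = let x∈p , x∈q = x∈p∩q⁻ p q x∈p∩q in p#q x∈p x∈q
  ∣p∩q∣≡0 : ∣ p ∩ q ∣ ≡ 0
  ∣p∩q∣≡0 = trans (cong ∣_∣ (Empty-unique p∩q-empty)) (∣⊥∣≡0 n)

∣p∣+∣q∣+∣r∣≤n+1 : {z : Fin n} (p q r : Subset n) → p ∩ q ⊆ ⁅ z ⁆ → Disjoint p r → Disjoint q r
                → ∣ p ∣ + ∣ q ∣ + ∣ r ∣ ≤ n + 1
∣p∣+∣q∣+∣r∣≤n+1 {n} {z} p q r p∩q⊆z p#r q#r = begin
  ∣ p ∣ + ∣ q ∣ + ∣ r ∣                 ≡⟨ cong (_+ ∣ r ∣) (∣p∪q∣+∣p∩q∣≡∣p∣+∣q∣ p q) ⟨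
  ∣ p ∪ q ∣ + ∣ p ∩ q ∣ + ∣ r ∣         ≤⟨ +-monoˡ-≤ (∣ r ∣) (+-monoʳ-≤ (∣ p ∪ q ∣) ∣p∩q∣≤1) ⟩
  ∣ p ∪ q ∣ + 1 + ∣ r ∣                 ≡⟨ +-assoc (∣ p ∪ q ∣) 1 (∣ r ∣) ⟩
  ∣ p ∪ q ∣ + suc ∣ r ∣                 ≡⟨ +-suc (∣ p ∪ q ∣) (∣ r ∣) ⟩
  suc (∣ p ∪ q ∣ + ∣ r ∣)               ≡⟨ cong suc (disjoint⇒∣p∪q∣≡∣p∣+∣q∣ (p ∪ q) r p∪q#r) ⟨
  suc ∣ (p ∪ q) ∪ r ∣                   ≤⟨ s≤s (∣p∣≤n ((p ∪ q) ∪ r)) ⟩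
  suc n                                 ≡⟨ +-comm 1 n ⟩
  n + 1                                 ∎
  where
  open ≤-Reasoning
  ∣p∩q∣≤1 : ∣ p ∩ q ∣ ≤ 1
  ∣p∩q∣≤1 = ≤-trans (p⊆q⇒∣p∣≤∣q∣ p∩q⊆z) (≤-reflexive (∣⁅x⁆∣≡1 z))
  p∪q#r : Disjoint (p ∪ q) r
  p∪q#r x∈p∪q with x∈p∪q⁻ p q x∈p∪q
  ... | inj₁ x∈p = p#r x∈p
  ... | inj₂ x∈q = q#r x∈q

index : (p : Subset n) (x : Fin n) → .(x ∈ p) → Fin ∣ p ∣
index (true  ∷ p) zero    _   = zero
index (true  ∷ p) (suc x) x∈p = suc (index p x (drop-there x∈p))
index (false ∷ p) zero    x∈p = ⊥-elim-irr (zero∉ x∈p)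
  where
  zero∉ : zero ∉ false ∷ p
  zero∉ ()
index (false ∷ p) (suc x) x∈p = index p x (drop-there x∈p)

index-injective : {p : Subset n} {x y : Fin n} (x∈p : x ∈ p) (y∈p : y ∈ p)
                → index p x x∈p ≡ index p y y∈p → x ≡ y
index-injective {p = true  ∷ p} here        here        _ = refl
index-injective {p = true  ∷ p} (there x∈p) (there y∈p) eq =
  cong suc (index-injective x∈p y∈p (suc-injective eq))
index-injective {p = false ∷ p} (there x∈p) (there y∈p) eq = cong suc (index-injective x∈p y∈p eq)

index-surjective : (p : Subset n) (j : Fin ∣ p ∣) → ∃[ x ] Σ (x ∈ p) λ x∈p → index p x x∈p ≡ j
index-surjective (true  ∷ p) zero    = zero , here , refl
index-surjective (true  ∷ p) (suc j) with index-surjective p j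
... | x , x∈p , refl = suc x , there x∈p , refl
index-surjective (false ∷ p) j with index-surjective p j
... | x , x∈p , refl = suc x , there x∈p , refl

module _ {n m : ℕ} (f : Fin n → Fin m) where

  image : Subset m
  image = tabulate (λ y → ⌊ any? (λ x → f x ≟ᶠ y) ⌋)

  ∈-image⁺ : (x : Fin n) → f x ∈ image
  ∈-image⁺ x = ∈-tabulate⁺ (fromWitness (x , refl))

  ∈-image⁻ : {y : Fin m} → y ∈ image → ∃[ x ] f x ≡ y
  ∈-image⁻ y∈ = toWitness (∈-tabulate⁻ y∈)

  onto-image : Fin n → Fin ∣ image ∣
  onto-image x = index image (f x) (∈-image⁺ x)

  onto-image-surjective : Surjective _≡_ _≡_ onto-image
  onto-image-surjective j with index-surjective image j
  ... | y , y∈ , refl with ∈-image⁻ y∈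
  ...   | x , refl = x , λ { refl → refl }

  onto-image-≡⇒ : {x x′ : Fin n} → onto-image x ≡ onto-image x′ → f x ≡ f x′
  onto-image-≡⇒ {x} {x′} = index-injective (∈-image⁺ x) (∈-image⁺ x′)

module _ {n : ℕ} where

  -- definitionally equal to endpoints G, for every G
  ends : List (Fin n × Fin n) → List (Fin n)
  ends = concatMap (λ e → proj₁ e ∷ proj₂ e ∷ [])

  seconds : List (Fin n × Fin n) → Subset n
  seconds []            = ⊥
  seconds ((x , y) ∷ M) = ⁅ y ⁆ ∪ seconds M

  leader : List (Fin n × Fin n) → Fin n → Fin n
  leader []            v = v
  leader ((x , y) ∷ M) v with v ≟ᶠ y
  ... | yes _ = x
  ... | no  _ = leader M v

  mate : List (Fin n × Fin n) → Fin n → Fin n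
  mate []            w = w
  mate ((x , y) ∷ M) w with w ≟ᶠ x | w ≟ᶠ y
  ... | yes _ | _     = y
  ... | no  _ | yes _ = x
  ... | no  _ | no  _ = mate M w

  seconds⊆ : {q : Subset n} (M : List (Fin n × Fin n)) → All (λ e → proj₂ e ∈ q) M → seconds M ⊆ q
  seconds⊆ []            _            z∈ = contradiction z∈ ∉⊥
  seconds⊆ ((x , y) ∷ M) (y∈q ∷ M⊆q) z∈ with x∈p∪q⁻ ⁅ y ⁆ (seconds M) z∈
  ... | inj₁ z∈⁅y⁆ = subst (_∈ _) (sym (x∈⁅y⁆⇒x≡y y z∈⁅y⁆)) y∈q
  ... | inj₂ z∈M   = seconds⊆ M M⊆q z∈M

  fresh∉seconds : {z : Fin n} (M : List (Fin n × Fin n)) → All (z ≢_) (ends M) → z ∉ seconds M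
  fresh∉seconds []            _                z∈ = ∉⊥ z∈
  fresh∉seconds ((x , y) ∷ M) (_ ∷ z≢y ∷ z∉M) z∈ with x∈p∪q⁻ ⁅ y ⁆ (seconds M) z∈
  ... | inj₁ z∈⁅y⁆ = z≢y (x∈⁅y⁆⇒x≡y y z∈⁅y⁆)
  ... | inj₂ z∈M   = fresh∉seconds M z∉M z∈M

  ∣seconds∣≡length : (M : List (Fin n × Fin n)) → Unique (ends M) → ∣ seconds M ∣ ≡ length M
  ∣seconds∣≡length []            _                   = ∣⊥∣≡0 n
  ∣seconds∣≡length ((x , y) ∷ M) (_ ∷ y∉M ∷ unique) = begin
    ∣ ⁅ y ⁆ ∪ seconds M ∣        ≡⟨ disjoint⇒∣p∪q∣≡∣p∣+∣q∣ ⁅ y ⁆ (seconds M) y#M ⟩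
    ∣ ⁅ y ⁆ ∣ + ∣ seconds M ∣    ≡⟨ cong₂ _+_ (∣⁅x⁆∣≡1 y) (∣seconds∣≡length M unique) ⟩
    suc (length M)              ∎
    where
    open ≡-Reasoning
    y#M : Disjoint ⁅ y ⁆ (seconds M)
    y#M z∈⁅y⁆ = subst (_∉ seconds M) (sym (x∈⁅y⁆⇒x≡y y z∈⁅y⁆)) (fresh∉seconds M y∉M)

  leader-preserves : {P : Fin n → Set} (M : List (Fin n × Fin n)) {v : Fin n}
                   → All (P ∘ proj₁) M → P v → P (leader M v)
  leader-preserves []            _            Pv = Pv
  leader-preserves ((x , y) ∷ M) {v} (Px ∷ PM) Pv with v ≟ᶠ y
  ... | yes _ = Px
  ... | no  _ = leader-preserves M PM Pv

  leader-fresh : {z : Fin n} (M : List (Fin n × Fin n)) {v : Fin n}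
               → All (z ≢_) (ends M) → leader M v ≡ z → v ≡ z
  leader-fresh []            _                  eq = eq
  leader-fresh ((x , y) ∷ M) {v} (z≢x ∷ _ ∷ z∉M) eq with v ≟ᶠ y
  ... | yes _ = contradiction (sym eq) z≢x
  ... | no  _ = leader-fresh M z∉M eq

  leader∉seconds : (M : List (Fin n × Fin n)) (v : Fin n) → Unique (ends M) → leader M v ∉ seconds M
  leader∉seconds []            v _ = ∉⊥
  leader∉seconds ((x , y) ∷ M) v ((x≢y ∷ x∉M) ∷ y∉M ∷ unique) with v ≟ᶠ y
  ... | yes _ = λ x∈ → [ (λ x∈⁅y⁆ → x≢y (x∈⁅y⁆⇒x≡y y x∈⁅y⁆)) , fresh∉seconds M x∉M ]′ (x∈p∪q⁻ ⁅ y ⁆ (seconds M) x∈)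
  ... | no v≢y = λ l∈ → [ (λ l∈⁅y⁆ → v≢y (leader-fresh M y∉M (x∈⁅y⁆⇒x≡y y l∈⁅y⁆))) , leader∉seconds M v unique ]′
                            (x∈p∪q⁻ ⁅ y ⁆ (seconds M) l∈)

  mate-fresh : (M : List (Fin n × Fin n)) {w : Fin n} → All (w ≢_) (ends M) → mate M w ≡ w
  mate-fresh []            _                  = refl
  mate-fresh ((x , y) ∷ M) {w} (w≢x ∷ w≢y ∷ w∉M) with w ≟ᶠ x | w ≟ᶠ y
  ... | yes w≡x | _       = contradiction w≡x w≢x
  ... | no  _   | yes w≡y = contradiction w≡y w≢y
  ... | no  _   | no  _   = mate-fresh M w∉M

  mate-related : (R : Fin n → Fin n → Set) → (∀ {x y} → R x y → R y x) → (M : List (Fin n × Fin n))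
               → All (λ e → R (proj₁ e) (proj₂ e)) M → (w : Fin n) → mate M w ≡ w ⊎ R w (mate M w)
  mate-related R sym-R []            _          w = inj₁ refl
  mate-related R sym-R ((x , y) ∷ M) (Rxy ∷ RM) w with w ≟ᶠ x | w ≟ᶠ y
  ... | yes refl | _       = inj₂ Rxy
  ... | no  _    | yes refl = inj₂ (sym-R Rxy)
  ... | no  _    | no  _    = mate-related R sym-R M RM w

  mate-first : (M : List (Fin n × Fin n)) (x y : Fin n) → mate ((x , y) ∷ M) x ≡ y
  mate-first M x y with x ≟ᶠ x
  ... | yes _   = refl
  ... | no  x≢x = contradiction refl x≢x

  mate-second : (M : List (Fin n × Fin n)) {x y : Fin n} → x ≢ y → mate ((x , y) ∷ M) y ≡ x
  mate-second M {x} {y} x≢y with y ≟ᶠ x | y ≟ᶠ y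
  ... | yes y≡x | _       = contradiction (sym y≡x) x≢y
  ... | no  _   | yes _   = refl
  ... | no  _   | no  y≢y = contradiction refl y≢y

  mate-other : (M : List (Fin n × Fin n)) {x y w : Fin n} → w ≢ x → w ≢ y → mate ((x , y) ∷ M) w ≡ mate M w
  mate-other M {x} {y} {w} w≢x w≢y with w ≟ᶠ x | w ≟ᶠ y
  ... | yes w≡x | _       = contradiction w≡x w≢x
  ... | no  _   | yes w≡y = contradiction w≡y w≢y
  ... | no  _   | no  _   = refl

  leader-second : (M : List (Fin n × Fin n)) (x y : Fin n) → leader ((x , y) ∷ M) y ≡ x
  leader-second M x y with y ≟ᶠ y
  ... | yes _   = refl
  ... | no  y≢y = contradiction refl y≢y

  leader-other : (M : List (Fin n × Fin n)) {x y v : Fin n} → v ≢ y → leader ((x , y) ∷ M) v ≡ leader M v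
  leader-other M {y = y} {v} v≢y with v ≟ᶠ y
  ... | yes v≡y = contradiction v≡y v≢y
  ... | no  _   = refl

  leader-≡⇒ : (M : List (Fin n × Fin n)) (u w : Fin n) → Unique (ends M)
            → leader M u ≡ leader M w → u ≡ w ⊎ u ≡ mate M w
  leader-≡⇒ []            u w _ eq = inj₁ eq
  leader-≡⇒ ((x , y) ∷ M) u w ((x≢y ∷ x∉M) ∷ y∉M ∷ unique) eq = cases (u ≟ᶠ y) (w ≟ᶠ y) (w ≟ᶠ x)
    where
    M′ = (x , y) ∷ M
    cases : Dec (u ≡ y) → Dec (w ≡ y) → Dec (w ≡ x) → u ≡ w ⊎ u ≡ mate M′ w
    cases (yes refl) (yes refl) _ = inj₁ refl
    cases (yes refl) (no w≢y) _ = inj₂ (trans (sym (mate-first M x y)) (cong (mate M′) (sym w≡x)))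
      where
      w≡x : w ≡ x
      w≡x = leader-fresh M x∉M (trans (sym (leader-other M w≢y)) (trans (sym eq) (leader-second M x y)))
    cases (no u≢y) (yes refl) _ = inj₂ (trans u≡x (sym (mate-second M x≢y)))
      where
      u≡x : u ≡ x
      u≡x = leader-fresh M x∉M (trans (sym (leader-other M u≢y)) (trans eq (leader-second M x y)))
    cases (no u≢y) (no w≢y) w≟x
      with leader-≡⇒ M u w unique (trans (sym (leader-other M u≢y)) (trans eq (leader-other M w≢y))) | w≟x
    ... | inj₁ u≡w      | _        = inj₁ u≡w
    ... | inj₂ u≡mate-w | yes refl = inj₁ (trans u≡mate-w (mate-fresh M x∉M))
    ... | inj₂ u≡mate-w | no  w≢x  = inj₂ (trans u≡mate-w (sym (mate-other M w≢x w≢y)))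

complement-nonadjacent : {G : SimpleGraph n} {x y : Fin n} → T (Adj (complement G) x y) → Adj G x y ≡ false
complement-nonadjacent t = Equivalence.to T-not-≡ (proj₂ (Equivalence.to T-∧ t))

module MatchingColouring {n : ℕ} (G : SimpleGraph n) {I : Subset n} (I-independent : Independent G I)
  {i₀ : Fin n} (i₀∈I : i₀ ∈ I) {M : List (Fin n × Fin n)} (M-matching : IsMatchingIn (complement G) (∁ I) M)
  where

  M-unique : Unique (ends M)
  M-unique = proj₂ M-matching

  M-nonadjacent : All (λ e → Adj G (proj₁ e) (proj₂ e) ≡ false) M
  M-nonadjacent = All.map (λ (_ , _ , x≁ᶜy) → complement-nonadjacent {G = G} x≁ᶜy) (proj₁ M-matching)

  colour : Fin n → Fin n
  colour v with v ∈? I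
  ... | yes _ = i₀
  ... | no  _ = leader M v

  colour-∈ : {v : Fin n} → v ∈ I → colour v ≡ i₀
  colour-∈ {v} v∈I with v ∈? I
  ... | yes _   = refl
  ... | no  v∉I = contradiction v∈I v∉I

  colour-∉ : {v : Fin n} → v ∉ I → colour v ≡ leader M v
  colour-∉ {v} v∉I with v ∈? I
  ... | yes v∈I = contradiction v∈I v∉I
  ... | no  _   = refl

  colour-∉I : {v : Fin n} → v ∉ I → colour v ∉ I
  colour-∉I {v} v∉I = subst (_∉ I) (sym (colour-∉ v∉I))
    (leader-preserves M (All.map (x∈∁p⇒x∉p ∘ proj₁) (proj₁ M-matching)) v∉I)

  colour-≡⇒ : {u w : Fin n} → w ∉ I → colour u ≡ colour w → u ≡ w ⊎ u ≡ mate M w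
  colour-≡⇒ {u} {w} w∉I eq = case u ∈? I of λ where
    (yes u∈I) → contradiction (subst (_∈ I) (trans (sym (colour-∈ u∈I)) eq) i₀∈I) (colour-∉I w∉I)
    (no  u∉I) → leader-≡⇒ M u w M-unique (trans (sym (colour-∉ u∉I)) (trans eq (colour-∉ w∉I)))

  colour-≡⇒nonadjacent : {u w : Fin n} → w ∉ I → colour u ≡ colour w → Adj G u w ≡ false
  colour-≡⇒nonadjacent {u} {w} w∉I eq with colour-≡⇒ {u} w∉I eq
  ... | inj₁ refl = adj-irrefl G u
  ... | inj₂ refl with mate-related (λ x y → Adj G x y ≡ false) (λ {x} {y} → trans (adj-sym G y x)) M
                         M-nonadjacent w
  ...   | inj₁ mate≡w = subst (λ z → Adj G z w ≡ false) (sym mate≡w) (adj-irrefl G w)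
  ...   | inj₂ w≁mate = trans (adj-sym G (mate M w) w) w≁mate

  colour-proper : (u v : Fin n) → T (Adj G u v) → colour u ≢ colour v
  colour-proper u v u~v eq = true≢false (case ((u ∈? I) , (v ∈? I)) of λ where
    (_       , no v∉I)  → colour-≡⇒nonadjacent v∉I eq
    (yes u∈I , yes v∈I) → I-independent u v u∈I v∈I
    (no u∉I  , yes _)   → trans (adj-sym G u v) (colour-≡⇒nonadjacent u∉I (sym eq)))
    where
    true≢false : Adj G u v ≢ false
    true≢false = subst (_≢ false) (sym (Equivalence.to T-≡ u~v)) λ ()

  colours : ℕ
  colours = ∣ image colour ∣

  md-colouring : Fin n → Fin colours
  md-colouring = onto-image colour

  private
    C : Fin colours → Subset n
    C = ColourClass G md-colouring

  ∈-own-class : (w : Fin n) → w ∈ C (md-colouring w)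
  ∈-own-class w = ∈-tabulate⁺ (fromWitness refl)

  ∣class∣≤2 : {w : Fin n} → w ∉ I → ∣ C (md-colouring w) ∣ ≤ 2
  ∣class∣≤2 {w} w∉I = begin
    ∣ C (md-colouring w) ∣          ≤⟨ p⊆q⇒∣p∣≤∣q∣ class⊆ ⟩
    ∣ ⁅ w ⁆ ∪ ⁅ mate M w ⁆ ∣        ≤⟨ ∣p∪q∣≤∣p∣+∣q∣ ⁅ w ⁆ ⁅ mate M w ⁆ ⟩
    ∣ ⁅ w ⁆ ∣ + ∣ ⁅ mate M w ⁆ ∣    ≡⟨ cong₂ _+_ (∣⁅x⁆∣≡1 w) (∣⁅x⁆∣≡1 (mate M w)) ⟩
    2                               ∎
    where
    open ≤-Reasoning
    class⊆ : C (md-colouring w) ⊆ ⁅ w ⁆ ∪ ⁅ mate M w ⁆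
    class⊆ {u} u∈ with colour-≡⇒ {u} w∉I (onto-image-≡⇒ colour {u} {w} (toWitness (∈-tabulate⁻ u∈)))
    ... | inj₁ refl = x∈p∪q⁺ (inj₁ (x∈⁅x⁆ u))
    ... | inj₂ refl = x∈p∪q⁺ (inj₂ (x∈⁅x⁆ (mate M w)))

  majority-at : {v w : Fin n} → w ∉ I → w ∈ ClosedNbhd G v
              → ∣ C (md-colouring w) ∣ ≤ 2 * ∣ ClosedNbhd G v ∩ C (md-colouring w) ∣
  majority-at {v} {w} w∉I w∈N[v] = ≤-trans (∣class∣≤2 w∉I) (*-monoʳ-≤ 2 one≤)
    where
    one≤ : 1 ≤ ∣ ClosedNbhd G v ∩ C (md-colouring w) ∣
    one≤ = subst (_≤ ∣ ClosedNbhd G v ∩ C (md-colouring w) ∣) (∣⁅x⁆∣≡1 w) (p⊆q⇒∣p∣≤∣q∣ λ z∈⁅w⁆ →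
             subst (_∈ _) (sym (x∈⁅y⁆⇒x≡y w z∈⁅w⁆)) (x∈p∩q⁺ (w∈N[v] , ∈-own-class w)))

  md-colouring-isMDColouring : (∀ v → ∃[ w ] w ∉ I × w ∈ ClosedNbhd G v) → IsMDColouring G colours md-colouring
  md-colouring-isMDColouring dominated =
      onto-image-surjective colour
    , (λ u v u~v eq → colour-proper u v u~v (onto-image-≡⇒ colour {u} {v} eq))
    , λ v → let w , w∉I , w∈N[v] = dominated v in md-colouring w , majority-at w∉I w∈N[v]

  colours+∣I∣+∣M∣≤n+1 : colours + ∣ I ∣ + length M ≤ n + 1
  colours+∣I∣+∣M∣≤n+1 = subst (λ k → colours + ∣ I ∣ + k ≤ n + 1) (∣seconds∣≡length M M-unique)
    (∣p∣+∣q∣+∣r∣≤n+1 (image colour) I (seconds M) image∩I⊆i₀ image#seconds I#seconds)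
    where
    seconds⊆∁I : seconds M ⊆ ∁ I
    seconds⊆∁I = seconds⊆ M (All.map (proj₁ ∘ proj₂) (proj₁ M-matching))
    I#seconds : Disjoint I (seconds M)
    I#seconds v∈I v∈S = x∈∁p⇒x∉p (seconds⊆∁I v∈S) v∈I
    image∩I⊆i₀ : image colour ∩ I ⊆ ⁅ i₀ ⁆
    image∩I⊆i₀ y∈ with x∈p∩q⁻ (image colour) I y∈
    ... | y∈image , y∈I with ∈-image⁻ colour y∈image
    ...   | x , refl = case x ∈? I of λ where
      (yes x∈I) → subst (_∈ ⁅ i₀ ⁆) (sym (colour-∈ x∈I)) (x∈⁅x⁆ i₀)
      (no  x∉I) → contradiction y∈I (colour-∉I x∉I)
    image#seconds : Disjoint (image colour) (seconds M)
    image#seconds y∈image with ∈-image⁻ colour y∈image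
    ... | x , refl = case x ∈? I of λ where
      (yes x∈I) → subst (_∉ seconds M) (sym (colour-∈ x∈I)) (I#seconds i₀∈I)
      (no  x∉I) → subst (_∉ seconds M) (sym (colour-∉ x∉I)) (leader∉seconds M x M-unique)

module _ {n : ℕ} (G : SimpleGraph n) where

  walk-start-neighbour : {u v : Fin n} → Reach G u v → u ≢ v → ∃[ w ] T (Adj G u w)
  walk-start-neighbour here           u≢u = contradiction refl u≢u
  walk-start-neighbour (step u~w _)   _   = _ , u~w

  connected⇒neighbour : 2 ≤ n → Connected G → (u : Fin n) → ∃[ w ] T (Adj G u w)
  connected⇒neighbour (s≤s (s≤s _)) connected zero    = walk-start-neighbour (connected zero (suc zero)) λ ()
  connected⇒neighbour (s≤s (s≤s _)) connected (suc u) = walk-start-neighbour (connected (suc u) zero) λ ()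

  ∈-ClosedNbhd⁺ : {v w : Fin n} → w ≡ v ⊎ T (Adj G v w) → w ∈ ClosedNbhd G v
  ∈-ClosedNbhd⁺ {v} {w} w≡v⊎v~w = ∈-tabulate⁺ (Equivalence.from (T-∨ {⌊ w ≟ᶠ v ⌋} {Adj G v w})
    (Sum.map₁ fromWitness w≡v⊎v~w))

  connected⇒∁-dominates : 2 ≤ n → Connected G → {I : Subset n} → Independent G I
                       → ∀ v → ∃[ w ] w ∉ I × w ∈ ClosedNbhd G v
  connected⇒∁-dominates 2≤n connected {I} I-independent v = case v ∈? I of λ where
    (no  v∉I) → v , v∉I , ∈-ClosedNbhd⁺ (inj₁ refl)
    (yes v∈I) → let w , v~w = connected⇒neighbour 2≤n connected v in
      w , (λ w∈I → subst T (I-independent v w v∈I w∈I) v~w) , ∈-ClosedNbhd⁺ (inj₂ v~w)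

  maximum-independent-nonempty : Fin n → {I : Subset n} → MaximumIndependent G I → Nonempty I
  maximum-independent-nonempty v {I} (_ , I-maximum) with nonempty? I
  ... | yes I≠∅ = I≠∅
  ... | no  I=∅ = contradiction (I-maximum ⁅ v ⁆ singleton-independent) ∣⁅v⁆∣≰∣I∣
    where
    ∣⁅v⁆∣≰∣I∣ : ¬ ∣ ⁅ v ⁆ ∣ ≤ ∣ I ∣
    ∣⁅v⁆∣≰∣I∣ rewrite ∣⁅x⁆∣≡1 v | Empty-unique I=∅ | ∣⊥∣≡0 n = λ ()
    singleton-independent : Independent G ⁅ v ⁆
    singleton-independent u w u∈ w∈ rewrite x∈⁅y⁆⇒x≡y v u∈ | x∈⁅y⁆⇒x≡y v w∈ = adj-irrefl G v

m+n+o≤p⇒m≤p∸n∸o : ∀ {m n o p} → m + n + o ≤ p → m ≤ p ∸ n ∸ o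
m+n+o≤p⇒m≤p∸n∸o {m} {n} {o} {p} le =
  subst (m ≤_) (sym (∸-+-assoc p n o)) (m+n≤o⇒m≤o∸n m (subst (_≤ p) (+-assoc m n o) le))

corollary2p3 : (n : ℕ) → 2 ≤ n → (G : SimpleGraph n) → Connected G
    → (I : Subset n) → MaximumIndependent G I
    → (a : ℕ) → IsIndependenceNumber G a
    → (m : ℕ) → IsMatchingNumberIn (complement G) (∁ I) m
    → (k : ℕ) → IsMDChromaticNumber G k
    → k ≤ n + 1 ∸ a ∸ m
corollary2p3 n 2≤n G connected I I-maximum@(I-independent , I-largest) a ((J , J-independent , refl) , _)
             m ((M , M-matching , refl) , _) k (_ , k-minimal) = begin
  k                  ≤⟨ k-minimal colours md-colouring
                          (md-colouring-isMDColouring (connected⇒∁-dominates G 2≤n connected I-independent)) ⟩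
  colours            ≤⟨ m+n+o≤p⇒m≤p∸n∸o colours+∣I∣+∣M∣≤n+1 ⟩
  n + 1 ∸ ∣ I ∣ ∸ m  ≤⟨ ∸-monoˡ-≤ m (∸-monoʳ-≤ (n + 1) (I-largest J J-independent)) ⟩
  n + 1 ∸ a ∸ m      ∎
  where
  open ≤-Reasoning
  i₀∈I = proj₂ (maximum-independent-nonempty G (fromℕ< 2≤n) I-maximum)
  open MatchingColouring G I-independent i₀∈I M-matching
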